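{- Let $D$ be a digraph with $n$ vertices that contains a directed cycle, and let $g$ be its girth. Then $\chi(D)\leq \left\lfloor\frac{n-1}{g-1}\right\rfloor+1$.
   Context: All digraphs are finite, loopless and strict (at most one edge from $u$ to $v$ for distinct $u,v$). The girth is the length of a shortest directed cycle. A proper $k$-coloring of $D$ is a partition of $V(D)$ into at most $k$ acyclic sets (sets whose induced subdigraph has no directed cycle); $\chi(D)$ is the minimum such $k$. -}

module Defs where

open import Data.Nat using (ℕ; zero; suc; _+_; _∸_; _≤_; _/_)
open import Data.Fin using (Fin)
open import Data.List using (List; []; _∷_; length)
open import Data.List.Relation.Unary.All using (All)
open import Data.List.Relation.Unary.Unique.Propositional using (Unique)
open import Data.Product using (Σ; _×_; ∃)
open import Relation.Nullary using (¬_)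
open import Relation.Binary using (Decidable)
open import Relation.Binary.PropositionalEquality using (_≡_)
open import Level using (0ℓ)

-- A finite, loopless, strict digraph on vertex set Fin n:
-- an (decidable) edge relation with no loops.  Strictness (at most one
-- edge u→v) is automatic since edges are given by a relation.
record Digraph (n : ℕ) : Set₁ where
  field
    Edge     : Fin n → Fin n → Set
    edge?    : Decidable Edge
    loopless : ∀ v → ¬ Edge v v

data Path {n : ℕ} (E : Fin n → Fin n → Set) : Fin n → List (Fin n) → Set where
  single : ∀ {v} → Path E v (v ∷ [])
  step   : ∀ {u v vs} → E u v → Path E v (v ∷ vs) → Path E u (u ∷ v ∷ vs)

last : {A : Set} → A → List A → A
last a []       = a
last a (b ∷ bs) = last b bs

-- A directed cycle v₀ → v₁ → … → v_{k-1} → v₀ on distinct vertices,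
-- given as the list (v₀ ∷ vs); its length is the number of vertices.
record DirCycle {n : ℕ} (E : Fin n → Fin n → Set) : Set where
  constructor mkCycle
  field
    v₀       : Fin n
    vs       : List (Fin n)
    path     : Path E v₀ (v₀ ∷ vs)
    closing  : E (last v₀ vs) v₀
    distinct : Unique (v₀ ∷ vs)

cycleLength : ∀ {n} {E : Fin n → Fin n → Set} → DirCycle E → ℕ
cycleLength c = suc (length (DirCycle.vs c))

HasCycle : ∀ {n} → Digraph n → Set
HasCycle D = DirCycle (Digraph.Edge D)

IsGirth : ∀ {n} → Digraph n → ℕ → Set
IsGirth D g =
  Σ (DirCycle (Digraph.Edge D)) (λ c → cycleLength c ≡ g)
  × (∀ (c : DirCycle (Digraph.Edge D)) → g ≤ cycleLength c)

-- A set S of vertices (predicate) is acyclic if the induced subdigraph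
-- has no directed cycle, i.e. no directed cycle of D lies inside S.
Acyclic : ∀ {n} → Digraph n → (Fin n → Set) → Set
Acyclic D S = ∀ (c : DirCycle (Digraph.Edge D)) →
  ¬ All S (DirCycle.v₀ c ∷ DirCycle.vs c)

-- A proper k-colouring: a map to Fin k whose colour classes are acyclic.
-- (A partition into at most k acyclic sets, empty classes allowed.)
record ProperColoring {n : ℕ} (D : Digraph n) (k : ℕ) : Set where
  field
    colour  : Fin n → Fin k
    acyclic : ∀ (i : Fin k) → Acyclic D (λ v → colour v ≡ i)

ChromLE : ∀ {n} → Digraph n → ℕ → Set
ChromLE D k = ProperColoring D k

-- ⌊(n-1)/(g-1)⌋ + 1, for g ≥ 2 (girth of a loopless digraph);
-- for g ≤ 1 (never arising) we return n as a dummy value.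
girthBound : ℕ → ℕ → ℕ
girthBound n zero          = n
girthBound n (suc zero)    = n
girthBound n (suc (suc h)) = (n ∸ 1) / suc h + 1

module Submission where

-- Let g ≥ 2 be the girth and put d = g - 1 ≥ 1.  Colour the
-- vertex v ∈ {0, …, n-1} by its block index ⌊v/d⌋ ∈ {0, …, ⌊(n-1)/d⌋}.
-- Inside one colour class a vertex is determined by its residue v mod d,
-- so a class has at most d < g vertices; a directed cycle has at least g
-- distinct vertices, hence no directed cycle lies inside a colour class.

open import Defs
open import Data.Nat using (ℕ; zero; suc; _+_; _*_; _∸_; _≤_; _<_; _/_; _%_; NonZero; s≤s; z≤n)
open import Data.Nat.Properties using (≤-pred; +-comm; <⇒≱)
open import Data.Nat.DivMod using (_mod_; /-monoˡ-≤; m≡m%n+[m/n]*n)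
open import Data.Fin using (Fin; toℕ; fromℕ<; zero; suc)
open import Data.Fin.Properties using (toℕ<n; toℕ-fromℕ<; toℕ-injective; injective⇒≤)
open import Data.List using (List; []; _∷_; length; lookup)
open import Data.List.Membership.Propositional.Properties using (∈-lookup)
open import Data.List.Relation.Unary.All as All using (All)
open import Data.List.Relation.Unary.AllPairs using (_∷_)
open import Data.List.Relation.Unary.Unique.Propositional using (Unique)
open import Data.Product using (_,_; proj₂)
open import Data.Empty using (⊥-elim)
open import Relation.Binary.PropositionalEquality using (_≡_; refl; sym; trans; cong; cong₂; module ≡-Reasoning)

lookup-injective : ∀ {A : Set} {xs : List A} → Unique xs →
  (i j : Fin (length xs)) → lookup xs i ≡ lookup xs j → i ≡ j
lookup-injective (_ ∷ _)       zero    zero    _  = refl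
lookup-injective (x∉xs ∷ _)    zero    (suc j) eq = ⊥-elim (All.lookup x∉xs (∈-lookup j) eq)
lookup-injective (x∉xs ∷ _)    (suc i) zero    eq = ⊥-elim (All.lookup x∉xs (∈-lookup i) (sym eq))
lookup-injective (_ ∷ unique)  (suc i) (suc j) eq = cong suc (lookup-injective unique i j eq)

length≤-if-injectiveOn : ∀ {A : Set} {P : A → Set} {d : ℕ} (f : A → Fin d) →
  (∀ {x y} → P x → P y → f x ≡ f y → x ≡ y) →
  ∀ {xs : List A} → All P xs → Unique xs → length xs ≤ d
length≤-if-injectiveOn {P = P} f injOnP {xs} allP unique =
  injective⇒≤ λ {i} {j} fi≡fj →
    lookup-injective unique i j (injOnP (P-at i) (P-at j) fi≡fj)
  where
    P-at : (i : Fin (length xs)) → P (lookup xs i)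
    P-at i = All.lookup allP (∈-lookup i)

divMod-injective : ∀ (d : ℕ) .{{_ : NonZero d}} (x y : ℕ) →
  x / d ≡ y / d → x % d ≡ y % d → x ≡ y
divMod-injective d x y q≡ r≡ = begin
  x                  ≡⟨ m≡m%n+[m/n]*n x d ⟩
  x % d + x / d * d  ≡⟨ cong₂ (λ r q → r + q * d) r≡ q≡ ⟩
  y % d + y / d * d  ≡⟨ sym (m≡m%n+[m/n]*n y d) ⟩
  y                  ∎
  where open ≡-Reasoning

-- The number of blocks {0..d-1}, {d..2d-1}, … meeting {0, …, n-1}.
blockCount : ℕ → (d : ℕ) .{{_ : NonZero d}} → ℕ
blockCount n d = (n ∸ 1) / d + 1

block< : ∀ {n} (d : ℕ) .{{_ : NonZero d}} (v : Fin n) → toℕ v / d < blockCount n d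
block< {suc m} d v rewrite +-comm (m / d) 1 = s≤s (/-monoˡ-≤ d (≤-pred (toℕ<n v)))

block : ∀ {n} (d : ℕ) .{{_ : NonZero d}} → Fin n → Fin (blockCount n d)
block d v = fromℕ< (block< d v)

residue : ∀ {n} (d : ℕ) .{{_ : NonZero d}} → Fin n → Fin d
residue d v = toℕ v mod d

residue-injectiveOnBlock : ∀ {n} (d : ℕ) .{{_ : NonZero d}} (i : Fin (blockCount n d))
  {x y : Fin n} → block d x ≡ i → block d y ≡ i → residue d x ≡ residue d y → x ≡ y
residue-injectiveOnBlock d i {x} {y} x∈i y∈i r≡ = toℕ-injective
  (divMod-injective d (toℕ x) (toℕ y)
    (trans (quotient x∈i) (sym (quotient y∈i)))
    (trans (sym (toℕ-fromℕ< _)) (trans (cong toℕ r≡) (toℕ-fromℕ< _))))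
  where
    quotient : ∀ {v : Fin _} → block d v ≡ i → toℕ v / d ≡ toℕ i
    quotient {v} v∈i = trans (sym (toℕ-fromℕ< (block< d v))) (cong toℕ v∈i)

-- If every directed cycle has more than d vertices, the block colouring is
-- proper: a cycle inside one class would be a duplicate-free list of at
-- most d vertices.
blockColouring : ∀ {n} (D : Digraph n) (d : ℕ) .{{_ : NonZero d}} →
  (∀ (c : DirCycle (Digraph.Edge D)) → d < cycleLength c) → ChromLE D (blockCount n d)
blockColouring D d longCycles = record
  { colour  = block d
  ; acyclic = λ i c inClass →
      <⇒≱ (longCycles c)
        (length≤-if-injectiveOn (residue d) (residue-injectiveOnBlock d i)
          inClass (DirCycle.distinct c))
  }

cycleLength≥2 : ∀ {n} (D : Digraph n) (c : DirCycle (Digraph.Edge D)) → 2 ≤ cycleLength c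
cycleLength≥2 D (mkCycle v₀ []      _ closing _) = ⊥-elim (Digraph.loopless D v₀ closing)
cycleLength≥2 D (mkCycle v₀ (_ ∷ _) _ _       _) = s≤s (s≤s z≤n)

girth≥2 : ∀ {n} (D : Digraph n) {g : ℕ} → IsGirth D g → 2 ≤ g
girth≥2 D ((c , refl) , _) = cycleLength≥2 D c

-- Theorem: χ(D) ≤ ⌊(n-1)/(g-1)⌋ + 1, via the block colouring with d = g - 1.
mainTheorem7 : (n : ℕ) (D : Digraph n) → HasCycle D → (g : ℕ) → IsGirth D g →
    ChromLE D (girthBound n g)
mainTheorem7 n D _ zero          isGirth with girth≥2 D isGirth
... | ()
mainTheorem7 n D _ (suc zero)    isGirth with girth≥2 D isGirth
... | s≤s ()
mainTheorem7 n D _ (suc (suc h)) isGirth = blockColouring D (suc h) (proj₂ isGirth)
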